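{- Let $\Gamma$ be a connected vertex-transitive graph that has no twin vertices and is not isomorphic to any Cayley graph $\mathrm{Cay}(\mathbb{Z}_n, S)$ with $1, -1 \in S$, for any $n \in \mathbb{N}$. Let $m \geq 2$. Then the lexicographic product $\tilde{\Gamma} = \Gamma[\overline{K_m}]$ contains no consistent walk (with respect to $\mathrm{Aut}(\tilde{\Gamma})$) whose stabilizer in $\mathrm{Aut}(\tilde{\Gamma})$ is trivial.
   Context: All graphs are finite and simple with at least three vertices. Two vertices $u, v$ are twin vertices if $\Gamma(u) = \Gamma(v)$, where $\Gamma(u)$ is the neighbourhood of $u$. $\overline{K_m}$ is the edgeless graph on $m$ vertices, and $\Gamma[\overline{K_m}]$ is the graph with vertex set $V(\Gamma) \times \{0, \ldots, m-1\}$ in which $(u,i)$ and $(v,j)$ are adjacent iff $u$ and $v$ are adjacent in $\Gamma$. A walk of length $n \geq 1$ is a tuple $(v_0, \ldots, v_n)$ of vertices with consecutive vertices adjacent; it is consistent if there is an automorphism $g$ of the graph with $v_i^g = v_{i+1}$ for all $i \in \{0, \ldots, n-1\}$. The stabilizer of a walk is the subgroup of automorphisms fixing each of its vertices. $\mathrm{Cay}(\mathbb{Z}_n, S)$ denotes the Cayley graph of the cyclic group $\mathbb{Z}_n$ with connection set $S$ (an inverse-closed subset not containing $0$). -}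

module Defs where

open import Data.Nat using (ℕ; zero; suc; _+_; _∸_; _≤_)
open import Data.Nat.DivMod using (_mod_)
open import Data.Fin using (Fin; toℕ; inject₁)
open import Data.Bool using (Bool; true; false)
open import Data.Product using (Σ; _×_; _,_; ∃)
open import Relation.Binary.PropositionalEquality using (_≡_)
open import Relation.Nullary using (¬_)

record Graph : Set where
  field
    size  : ℕ
    Adj   : Fin size → Fin size → Bool
    sym   : ∀ u v → Adj u v ≡ Adj v u
    irr   : ∀ u → Adj u u ≡ false
open Graph public

record Aut {V : Set} (A : V → V → Bool) : Set where
  field
    fun  : V → V
    inv  : V → V
    fun∘inv : ∀ x → fun (inv x) ≡ x
    inv∘fun : ∀ x → inv (fun x) ≡ x
    pres : ∀ x y → A (fun x) (fun y) ≡ A x y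
open Aut public

record Iso {V W : Set} (A : V → V → Bool) (B : W → W → Bool) : Set where
  field
    to   : V → W
    from : W → V
    to∘from : ∀ y → to (from y) ≡ y
    from∘to : ∀ x → from (to x) ≡ x
    pres : ∀ x y → B (to x) (to y) ≡ A x y

data Reach {V : Set} (A : V → V → Bool) : V → V → Set where
  here : ∀ {u} → Reach A u u
  step : ∀ {u v w} → A u v ≡ true → Reach A v w → Reach A u w

Connected : {V : Set} → (V → V → Bool) → Set
Connected A = ∀ u v → Reach A u v

VertexTransitive : {V : Set} → (V → V → Bool) → Set
VertexTransitive A = ∀ u v → Σ (Aut A) λ σ → fun σ u ≡ v

NoTwins : {V : Set} → (V → V → Bool) → Set
NoTwins A = ∀ u v → (∀ w → A u w ≡ A v w) → u ≡ v

-- A walk of length (suc k) ≥ 1: vertices w 0 , … , w (suc k)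
IsWalk : {V : Set} (A : V → V → Bool) (k : ℕ) → (Fin (suc (suc k)) → V) → Set
IsWalk A k w = ∀ (i : Fin (suc k)) → A (w (inject₁ i)) (w (Data.Fin.suc i)) ≡ true

Consistent : {V : Set} (A : V → V → Bool) (k : ℕ) → (Fin (suc (suc k)) → V) → Set
Consistent A k w = Σ (Aut A) λ σ → ∀ (i : Fin (suc k)) → fun σ (w (inject₁ i)) ≡ w (Data.Fin.suc i)

TrivialStabilizer : {V : Set} (A : V → V → Bool) (k : ℕ) → (Fin (suc (suc k)) → V) → Set
TrivialStabilizer A k w = ∀ (σ : Aut A) → (∀ j → fun σ (w j) ≡ w j) → ∀ x → fun σ x ≡ x

CayAdj : (k : ℕ) → (Fin (suc k) → Bool) → Fin (suc k) → Fin (suc k) → Bool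
CayAdj k S x y = S ((toℕ y + (suc k ∸ toℕ x)) mod (suc k))     -- x ~ y iff y - x ∈ S

-- S is a connection set (0 ∉ S, S = -S) containing 1 and -1
GoodConnSet : (k : ℕ) → (Fin (suc k) → Bool) → Set
GoodConnSet k S =
  (S (0 mod suc k) ≡ false)
  × (∀ x → S x ≡ S ((suc k ∸ toℕ x) mod suc k))
  × (S (1 mod suc k) ≡ true)
  × (S ((suc k ∸ 1) mod suc k) ≡ true)

IsCycleCayley : Graph → Set
IsCycleCayley Γ = Σ ℕ λ k → Σ (Fin (suc k) → Bool) λ S →
  GoodConnSet k S × Iso (Adj Γ) (CayAdj k S)

LexAdj : (Γ : Graph) (m : ℕ) → (Fin (size Γ) × Fin m) → (Fin (size Γ) × Fin m) → Bool
LexAdj Γ m (u , i) (v , j) = Adj Γ u v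

{-# OPTIONS --safe #-}
-- Since Γ has no twins, the twin classes of Γ[K̄ₘ] are exactly its fibres {u} × Fin m,
-- so every automorphism σ of Γ[K̄ₘ] permutes the fibres and induces an automorphism τ of Γ.
-- If the walk w is consistent via σ, its projection to Γ is the τ-orbit u₀, τ u₀, τ² u₀, ….
-- If the stabilizer of w is trivial, the walk meets every fibre, since swapping two points
-- of a fibre it misses fixes w. Hence τ is a single cycle through all N vertices, and
-- j ↦ τʲ u₀ is an isomorphism Cay(ℤ_N, S) ≅ Γ with S = {d | u₀ ~ τᵈ u₀}, which contains
-- ±1 because u₀ ~ τ u₀ is the first step of w.
module Submission where

open import Defs hiding (sym)
open import Data.Bool using (Bool; true; false)
open import Data.Empty using (⊥)
open import Data.Fin using (Fin; zero; suc; toℕ; inject₁; _≟_)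
open import Data.Fin.Permutation using (Permutation′; _⟨$⟩ʳ_; _⟨$⟩ˡ_; inverseˡ; inverseʳ; transpose)
  renaming (id to idₚ)
open import Data.Fin.Properties using (toℕ-fromℕ<; toℕ<n; toℕ≤pred[n]; toℕ-injective; any?; pigeonhole; injective⇒≤)
open import Data.Nat using (ℕ; zero; suc; _+_; _*_; _∸_; _≤_; _<_; s≤s; z≤n; NonZero; >-nonZero; _%_; _/_)
open import Data.Nat.DivMod using (_mod_; m≡m%n+[m/n]*n; m%n<n)
open import Data.Nat.GeneralisedArithmetic using (fold; fold-+)
open import Data.Nat.Properties
  using (+-comm; +-assoc; ≤-trans; ≤-<-trans; <⇒≤; <⇒≱; ≤-antisym; n<1+n; m≤n+m; m∸n≤m; m<n⇒0<n∸m;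
         +-∸-assoc; m+[n∸m]≡n; <-cmp)
open import Data.Product using (Σ; _×_; _,_; proj₁; proj₂; ∃)
open import Function using (_∘_)
open import Function.Definitions using (Injective)
open import Relation.Binary using (tri<; tri≈; tri>)
open import Relation.Binary.PropositionalEquality using (_≡_; _≢_; refl; sym; trans; cong; cong₂; subst; module ≡-Reasoning)
open import Relation.Nullary using (¬_; yes; no; contradiction)

Twins : {V : Set} → (V → V → Bool) → V → V → Set
Twins A x y = ∀ z → A x z ≡ A y z

Aut-preserves-Twins : {V : Set} {A : V → V → Bool} (σ : Aut A) {x y : V} →
                      Twins A x y → Twins A (fun σ x) (fun σ y)
Aut-preserves-Twins {A = A} σ {x} {y} twins z = begin
  A (fun σ x) z                ≡⟨ cong (A (fun σ x)) (sym (fun∘inv σ z)) ⟩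
  A (fun σ x) (fun σ (inv σ z)) ≡⟨ pres σ x (inv σ z) ⟩
  A x (inv σ z)                 ≡⟨ twins (inv σ z) ⟩
  A y (inv σ z)                 ≡⟨ sym (pres σ y (inv σ z)) ⟩
  A (fun σ y) (fun σ (inv σ z)) ≡⟨ cong (A (fun σ y)) (fun∘inv σ z) ⟩
  A (fun σ y) z                 ∎
  where open ≡-Reasoning

PreservesAdj : {V : Set} → (V → V → Bool) → (V → V) → Set
PreservesAdj A f = ∀ u v → A (f u) (f v) ≡ A u v

module _ {V : Set} {A : V → V → Bool} where

  PreservesAdj-injective : NoTwins A → {f : V → V} → PreservesAdj A f → Injective _≡_ _≡_ f
  PreservesAdj-injective noTwins {f} f-pres {u} {v} fu≡fv = noTwins u v λ z → begin
    A u z         ≡⟨ sym (f-pres u z) ⟩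
    A (f u) (f z) ≡⟨ cong (λ x → A x (f z)) fu≡fv ⟩
    A (f v) (f z) ≡⟨ f-pres v z ⟩
    A v z         ∎
    where open ≡-Reasoning

  fold-preservesAdj : {f : V → V} → PreservesAdj A f → ∀ a → PreservesAdj A (λ x → fold x f a)
  fold-preservesAdj f-pres zero    u v = refl
  fold-preservesAdj f-pres (suc a) u v = trans (f-pres _ _) (fold-preservesAdj f-pres a u v)

recurrence⇒fold : {X : Set} {n : ℕ} (g : Fin (suc n) → X) (s : X → X) →
                  (∀ i → g (suc i) ≡ s (g (inject₁ i))) → ∀ i → g i ≡ fold (g zero) s (toℕ i)
recurrence⇒fold g s next zero    = refl
recurrence⇒fold {n = suc n} g s next (suc i) =
  trans (next i) (cong s (recurrence⇒fold (g ∘ inject₁) s (next ∘ inject₁) i))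

module Orbit {k : ℕ} (A : Fin (suc k) → Fin (suc k) → Bool) (noTwins : NoTwins A)
             (τ : Fin (suc k) → Fin (suc k)) (τ-pres : PreservesAdj A τ)
             (u₀ : Fin (suc k)) (covers : ∀ u → ∃ λ j → fold u₀ τ j ≡ u) where

  N : ℕ
  N = suc k

  orbit : ℕ → Fin N
  orbit j = fold u₀ τ j

  index : Fin N → ℕ
  index u = proj₁ (covers u)

  orbit-index : ∀ u → orbit (index u) ≡ u
  orbit-index u = proj₂ (covers u)

  orbit-shift : ∀ a c → A (orbit a) (orbit (a + c)) ≡ A u₀ (orbit c)
  orbit-shift a c = trans (cong (A (orbit a)) (fold-+ u₀ τ a)) (fold-preservesAdj τ-pres a u₀ (orbit c))

  orbit-distance : ∀ {a b} → a ≤ b → A (orbit a) (orbit b) ≡ A u₀ (orbit (b ∸ a))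
  orbit-distance {a} a≤b = trans (cong (A (orbit a) ∘ orbit) (sym (m+[n∸m]≡n a≤b))) (orbit-shift a _)

  orbit-cancel : ∀ {a b} → a ≤ b → orbit a ≡ orbit b → orbit (b ∸ a) ≡ u₀
  orbit-cancel {a} {b} a≤b eq = PreservesAdj-injective noTwins (fold-preservesAdj τ-pres a) (begin
    fold (orbit (b ∸ a)) τ a ≡⟨ sym (fold-+ u₀ τ a) ⟩
    orbit (a + (b ∸ a))      ≡⟨ cong orbit (m+[n∸m]≡n a≤b) ⟩
    orbit b                  ≡⟨ sym eq ⟩
    orbit a                  ∎)
    where open ≡-Reasoning

  module Period {p : ℕ} (orbit-p : orbit p ≡ u₀) where

    orbit-period : ∀ j → orbit (j + p) ≡ orbit j
    orbit-period j = trans (fold-+ u₀ τ j) (cong (λ x → fold x τ j) orbit-p)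

    orbit-multiple : ∀ r d → orbit (r + d * p) ≡ orbit r
    orbit-multiple r zero    = cong orbit (+-comm r 0)
    orbit-multiple r (suc d) = begin
      orbit (r + (p + d * p)) ≡⟨ cong (orbit ∘ (r +_)) (+-comm p (d * p)) ⟩
      orbit (r + (d * p + p)) ≡⟨ cong orbit (sym (+-assoc r (d * p) p)) ⟩
      orbit (r + d * p + p)   ≡⟨ orbit-period (r + d * p) ⟩
      orbit (r + d * p)       ≡⟨ orbit-multiple r d ⟩
      orbit r                 ∎
      where open ≡-Reasoning

    orbit-mod : .{{_ : NonZero p}} → ∀ j → orbit (toℕ (j mod p)) ≡ orbit j
    orbit-mod j = begin
      orbit (toℕ (j mod p))       ≡⟨ cong orbit (toℕ-fromℕ< (m%n<n j p)) ⟩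
      orbit (j % p)               ≡⟨ sym (orbit-multiple (j % p) (j / p)) ⟩
      orbit (j % p + j / p * p)   ≡⟨ cong orbit (sym (m≡m%n+[m/n]*n j p)) ⟩
      orbit j                     ∎
      where open ≡-Reasoning

    -- Every vertex is some τʲ u₀ = τ^(j mod p) u₀, so u ↦ index u mod p is injective.
    N≤period : .{{_ : NonZero p}} → N ≤ p
    N≤period = injective⇒≤ residue-injective
      where
        residue : Fin N → Fin p
        residue u = index u mod p

        orbit-residue : ∀ u → orbit (toℕ (residue u)) ≡ u
        orbit-residue u = trans (orbit-mod (index u)) (orbit-index u)

        residue-injective : Injective _≡_ _≡_ residue
        residue-injective {u} {v} eq =
          trans (sym (orbit-residue u)) (trans (cong (orbit ∘ toℕ) eq) (orbit-residue v))

  open Period using (N≤period)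

  no-early-return : ∀ {a b} → a < b → b < N → orbit a ≡ orbit b → ⊥
  no-early-return {a} {b} a<b b<N eq =
    <⇒≱ (≤-<-trans (m∸n≤m b a) b<N)
        (N≤period (orbit-cancel (<⇒≤ a<b) eq) {{>-nonZero (m<n⇒0<n∸m a<b)}})

  orbit-injective : ∀ {a b} → a < N → b < N → orbit a ≡ orbit b → a ≡ b
  orbit-injective {a} {b} a<N b<N eq with <-cmp a b
  ... | tri< a<b _ _ = contradiction eq (no-early-return a<b b<N)
  ... | tri≈ _ a≡b _ = a≡b
  ... | tri> _ _ b<a = contradiction (sym eq) (no-early-return b<a a<N)

  orbit-returns : orbit N ≡ u₀
  orbit-returns with pigeonhole (n<1+n N) (orbit ∘ toℕ)
  ... | i , j , i<j , eq = subst (λ p → orbit p ≡ u₀) (≤-antisym j∸i≤N N≤j∸i) return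
    where
      return : orbit (toℕ j ∸ toℕ i) ≡ u₀
      return = orbit-cancel (<⇒≤ i<j) eq

      N≤j∸i : N ≤ toℕ j ∸ toℕ i
      N≤j∸i = N≤period return {{>-nonZero (m<n⇒0<n∸m i<j)}}

      j∸i≤N : toℕ j ∸ toℕ i ≤ N
      j∸i≤N = ≤-trans (m∸n≤m (toℕ j) (toℕ i)) (toℕ≤pred[n] j)

  open Period {N} orbit-returns using (orbit-period; orbit-mod)

  module Cayley (A-sym : ∀ u v → A u v ≡ A v u) (A-irr : ∀ u → A u u ≡ false)
                (first-step : A u₀ (τ u₀) ≡ true) where

    S : Fin N → Bool
    S d = A u₀ (orbit (toℕ d))

    S-mod : ∀ j → S (j mod N) ≡ A u₀ (orbit j)
    S-mod j = cong (A u₀) (orbit-mod j)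

    S-reflect : ∀ {d} → d ≤ N → A u₀ (orbit d) ≡ A u₀ (orbit (N ∸ d))
    S-reflect {d} d≤N = begin
      A u₀ (orbit d)         ≡⟨ A-sym u₀ (orbit d) ⟩
      A (orbit d) u₀         ≡⟨ cong (A (orbit d)) (sym orbit-returns) ⟩
      A (orbit d) (orbit N)  ≡⟨ orbit-distance d≤N ⟩
      A u₀ (orbit (N ∸ d))   ∎
      where open ≡-Reasoning

    S-connection : GoodConnSet k S
    S-connection = trans (S-mod 0) (A-irr u₀)
                 , (λ d → trans (S-reflect (<⇒≤ (toℕ<n d))) (sym (S-mod (N ∸ toℕ d))))
                 , trans (S-mod 1) first-step
                 , trans (S-mod (N ∸ 1)) (trans (sym (S-reflect (s≤s z≤n))) first-step)

    orbit-adjacency : ∀ {a} b → a ≤ N → A (orbit a) (orbit b) ≡ S ((b + (N ∸ a)) mod N)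
    orbit-adjacency {a} b a≤N = begin
      A (orbit a) (orbit b)            ≡⟨ cong (A (orbit a)) (sym (orbit-period b)) ⟩
      A (orbit a) (orbit (b + N))      ≡⟨ orbit-distance (≤-trans a≤N (m≤n+m N b)) ⟩
      A u₀ (orbit (b + N ∸ a))         ≡⟨ cong (A u₀ ∘ orbit) (+-∸-assoc b a≤N) ⟩
      A u₀ (orbit (b + (N ∸ a)))       ≡⟨ sym (S-mod (b + (N ∸ a))) ⟩
      S ((b + (N ∸ a)) mod N)          ∎
      where open ≡-Reasoning

    to : Fin N → Fin N
    to u = index u mod N

    from : Fin N → Fin N
    from i = orbit (toℕ i)

    from∘to : ∀ u → from (to u) ≡ u
    from∘to u = trans (orbit-mod (index u)) (orbit-index u)

    to∘from : ∀ i → to (from i) ≡ i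
    to∘from i = toℕ-injective (orbit-injective (toℕ<n (to (from i))) (toℕ<n i) (from∘to (from i)))

    cayley-iso : Iso A (CayAdj k S)
    cayley-iso = record
      { to = to ; from = from ; to∘from = to∘from ; from∘to = from∘to
      ; pres = λ x y → trans (sym (orbit-adjacency (toℕ (to y)) (<⇒≤ (toℕ<n (to x)))))
                             (cong₂ A (from∘to x) (from∘to y))
      }

orbit⇒IsCycleCayley : (Γ : Graph) → NoTwins (Adj Γ) → (τ : Fin (size Γ) → Fin (size Γ)) →
                      PreservesAdj (Adj Γ) τ → (u₀ : Fin (size Γ)) →
                      (∀ u → ∃ λ j → fold u₀ τ j ≡ u) → Adj Γ u₀ (τ u₀) ≡ true → IsCycleCayley Γ
orbit⇒IsCycleCayley record { size = suc k ; Adj = A ; sym = A-sym ; irr = A-irr }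
                    noTwins τ τ-pres u₀ covers first-step =
  k , S , S-connection , cayley-iso
  where open Orbit.Cayley A noTwins τ τ-pres u₀ covers A-sym A-irr first-step

module Lexicographic (Γ : Graph) (m : ℕ) where

  L : Fin (size Γ) × Fin m → Fin (size Γ) × Fin m → Bool
  L = LexAdj Γ m

  Aut-preserves-fibres : NoTwins (Adj Γ) → (σ : Aut L) →
                         ∀ u i j → proj₁ (fun σ (u , i)) ≡ proj₁ (fun σ (u , j))
  Aut-preserves-fibres noTwins σ u i j = noTwins _ _ λ v → Aut-preserves-Twins σ (λ _ → refl) (v , i)

  induced : Aut L → Fin m → Fin (size Γ) → Fin (size Γ)
  induced σ c u = proj₁ (fun σ (u , c))

  induced-preservesAdj : (σ : Aut L) (c : Fin m) → PreservesAdj (Adj Γ) (induced σ c)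
  induced-preservesAdj σ c u v = pres σ (u , c) (v , c)

  consistent-walk-orbit : NoTwins (Adj Γ) →
                          ∀ {k} (w : Fin (suc (suc k)) → Fin (size Γ) × Fin m) (σ : Aut L) →
                          (∀ i → fun σ (w (inject₁ i)) ≡ w (suc i)) →
                          ∀ c i → proj₁ (w i) ≡ fold (proj₁ (w zero)) (induced σ c) (toℕ i)
  consistent-walk-orbit noTwins w σ consistent c = recurrence⇒fold (proj₁ ∘ w) (induced σ c) λ i →
    trans (cong proj₁ (sym (consistent i))) (Aut-preserves-fibres noTwins σ _ _ c)

  fibrewise : (Fin (size Γ) → Permutation′ m) → Aut L
  fibrewise π = record
    { fun = λ (v , c) → v , π v ⟨$⟩ʳ c
    ; inv = λ (v , c) → v , π v ⟨$⟩ˡ c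
    ; fun∘inv = λ (v , c) → cong (v ,_) (inverseʳ (π v))
    ; inv∘fun = λ (v , c) → cong (v ,_) (inverseˡ (π v))
    ; pres = λ _ _ → refl
    }

module FibreSwap (Γ : Graph) (m : ℕ) where
  open Lexicographic Γ (suc (suc m))

  swapAt : Fin (size Γ) → Fin (size Γ) → Permutation′ (suc (suc m))
  swapAt u v with v ≟ u
  ... | yes _ = transpose zero (suc zero)
  ... | no _  = idₚ

  swapAt-elsewhere : ∀ {u v} → v ≢ u → ∀ c → swapAt u v ⟨$⟩ʳ c ≡ c
  swapAt-elsewhere {u} {v} v≢u c with v ≟ u
  ... | yes v≡u = contradiction v≡u v≢u
  ... | no _    = refl

  swapAt-moves : ∀ u → swapAt u u ⟨$⟩ʳ zero ≢ zero
  swapAt-moves u with u ≟ u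
  ... | yes _ = λ ()
  ... | no u≢u = λ _ → u≢u refl

  TrivialStabilizer⇒covers : ∀ {k} {w : Fin (suc (suc k)) → Fin (size Γ) × Fin (suc (suc m))} →
                             TrivialStabilizer L k w → ∀ u → ∃ λ j → proj₁ (w j) ≡ u
  TrivialStabilizer⇒covers {w = w} trivial u with any? (λ j → proj₁ (w j) ≟ u)
  ... | yes hit  = hit
  ... | no  miss =
    contradiction (cong proj₂ (trivial (fibrewise (swapAt u)) fixes-w (u , zero))) (swapAt-moves u)
    where
      fixes-w : ∀ j → fun (fibrewise (swapAt u)) (w j) ≡ w j
      fixes-w j = cong (proj₁ (w j) ,_) (swapAt-elsewhere (miss ∘ (j ,_)) (proj₂ (w j)))

lemma6p1 : (Γ : Graph) → 3 ≤ size Γ → Connected (Adj Γ) → VertexTransitive (Adj Γ)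
    → NoTwins (Adj Γ) → ¬ IsCycleCayley Γ → (m : ℕ) → 2 ≤ m
    → ¬ (Σ ℕ λ k → Σ (Fin (suc (suc k)) → Fin (size Γ) × Fin m) λ w →
    IsWalk (LexAdj Γ m) k w × Consistent (LexAdj Γ m) k w
    × TrivialStabilizer (LexAdj Γ m) k w)
lemma6p1 Γ _ _ _ noTwins notCayley (suc (suc m)) _ (k , w , walk , (σ , consistent) , trivial) =
  notCayley (orbit⇒IsCycleCayley Γ noTwins τ (induced-preservesAdj σ zero) u₀ covers first-step)
  where
    open Lexicographic Γ (suc (suc m))
    open FibreSwap Γ m using (TrivialStabilizer⇒covers)

    u₀ : Fin (size Γ)
    u₀ = proj₁ (w zero)

    τ : Fin (size Γ) → Fin (size Γ)
    τ = induced σ zero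

    w-orbit : ∀ i → proj₁ (w i) ≡ fold u₀ τ (toℕ i)
    w-orbit = consistent-walk-orbit noTwins w σ consistent zero

    covers : ∀ u → ∃ λ j → fold u₀ τ j ≡ u
    covers u with j , wj≡u ← TrivialStabilizer⇒covers trivial u = toℕ j , trans (sym (w-orbit j)) wj≡u

    first-step : Adj Γ u₀ (τ u₀) ≡ true
    first-step = subst (λ v → Adj Γ u₀ v ≡ true) (w-orbit (suc zero)) (walk zero)
lemma6p1 _ _ _ _ _ _ zero          ()
lemma6p1 _ _ _ _ _ _ (suc zero)    (s≤s ())
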